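{- Let $a_0,\ldots,a_4$ be non-zero integers each having all of its prime factors $\leqslant 4$, and let $F_{n,4}(x)=\sum_{j=0}^4 a_jc_jx^j$ where $c_j=(-1)^{4-j}\binom{n}{j}\binom{n-j-1}{4-j}$. For every integer $n$ with $8\leqslant n<5^3$ and $n\notin\{8,50,98,100\}$, the polynomial $F_{n,4}(x)$ is irreducible over $\mathbb{Q}$. -}

module Defs where

open import Data.Nat as ℕ using (ℕ; zero; suc; _∸_; _≤_)
open import Data.Nat.Combinatorics using (_C_)
open import Data.Nat.Divisibility using (_∣_)
open import Data.Nat.Primality using (Prime)
open import Data.Integer as ℤ using (ℤ; +_; -_; ∣_∣)
open import Data.Rational as ℚ using (ℚ; 0ℚ; _/_)
open import Data.List using (List; []; _∷_; map)
open import Data.Product using (_×_)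
open import Data.Sum using (_⊎_)
open import Relation.Binary.PropositionalEquality using (_≡_; _≢_)
open import Relation.Nullary using (¬_)

-- Polynomials over ℚ as coefficient lists, lowest degree first
-- (missing coefficients are 0, so trailing zeros are harmless).
Poly : Set
Poly = List ℚ

coeff : Poly → ℕ → ℚ
coeff []       _       = 0ℚ
coeff (a ∷ p)  zero    = a
coeff (a ∷ p)  (suc k) = coeff p k

_⊕_ : Poly → Poly → Poly
[]      ⊕ q       = q
(a ∷ p) ⊕ []      = a ∷ p
(a ∷ p) ⊕ (b ∷ q) = (a ℚ.+ b) ∷ (p ⊕ q)

_⊗_ : Poly → Poly → Poly
[]      ⊗ q = []
(a ∷ p) ⊗ q = map (a ℚ.*_) q ⊕ (0ℚ ∷ (p ⊗ q))

_≈ₚ_ : Poly → Poly → Set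
p ≈ₚ q = ∀ k → coeff p k ≡ coeff q k

IsConstant : Poly → Set
IsConstant p = ∀ k → 1 ≤ k → coeff p k ≡ 0ℚ

-- Irreducible in ℚ[x]: not a unit nor zero (i.e. non-constant; units of
-- ℚ[x] are the non-zero constants), and any factorisation has a constant
-- (hence unit, since the product is non-zero) factor.
Irreducible : Poly → Set
Irreducible f = ¬ IsConstant f × (∀ g h → f ≈ₚ (g ⊗ h) → IsConstant g ⊎ IsConstant h)

Smooth4 : ℤ → Set
Smooth4 a = (a ≢ + 0) × (∀ p → Prime p → p ∣ ∣ a ∣ → p ≤ 4)

-- c_j = (-1)^(4-j) * C(n,j) * C(n-j-1, 4-j)   (n ≥ 8 so n-j-1 ≥ 0)
sgn : ℕ → ℤ → ℤ
sgn zero    z = z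
sgn (suc k) z = - sgn k z

c : ℕ → ℕ → ℤ
c n j = sgn (4 ∸ j) (+ ((n C j) ℕ.* ((n ∸ j ∸ 1) C (4 ∸ j))))

F : ℕ → (a₀ a₁ a₂ a₃ a₄ : ℤ) → Poly
F n a₀ a₁ a₂ a₃ a₄ =
  ((a₀ ℤ.* c n 0) / 1) ∷ ((a₁ ℤ.* c n 1) / 1) ∷ ((a₂ ℤ.* c n 2) / 1) ∷
  ((a₃ ℤ.* c n 3) / 1) ∷ ((a₄ ℤ.* c n 4) / 1) ∷ []

{-# OPTIONS --safe #-}
-- Write F = Σ_k φ_k x^k with φ_k = a_k c_k. For each proper degree d ∈ {1, 2, 3} a certificate gives
-- a prime p ≥ 5 and an index j ∉ {d, 4 − d} such that p divides every c_k except c_j, p² ∤ c_0 unless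
-- j = 0, and p² ∤ c_4 unless j = 4; since the a_k are products of 2s and 3s, the φ_k behave the same.
-- So F ≡ u x^j (mod p). Clearing denominators and dividing out p (Gauss's lemma), a factorisation
-- F = g h of degrees d + e = 4 becomes one over ℤ in which neither factor vanishes mod p; as 𝔽ₚ[x] is
-- a domain, g ≡ v x^a and h ≡ w x^b with a + b = j. If a, b > 0 then p² divides the constant term,
-- and if a = 0 but e ≠ j then p² divides the leading coefficient (or e < j = 4). Hence d ∈ {j, 4 − j}.
module Submission where

open import Defs

open import Algebra.Bundles using (Semiring; CommutativeRing; CommutativeMonoid)
import Algebra.Properties.CommutativeSemigroup as CommutativeSemigroupProperties
open import Data.Bool using (if_then_else_)
open import Data.Empty using (⊥; ⊥-elim)
open import Data.Integer as ℤ using (ℤ; +_; 0ℤ)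
open import Data.Integer.Divisibility.Signed
import Data.Integer.Properties as ℤ
open import Data.Integer.Tactic.RingSolver using (solve-∀)
open import Data.List using (List; []; _∷_; map; length; concatMap)
open import Data.List.Relation.Unary.Any using (Any; any?; satisfied)
open import Data.Nat as ℕ using (ℕ; zero; suc; _∸_; _≤_; _<_; _≤?_; _<?_; _≡ᵇ_; z≤n; s≤s)
import Data.Nat.Divisibility as ℕ
open import Data.Nat.Induction as ℕ using ()
open import Data.Nat.Primality using (Prime; prime?; euclidsLemma; prime⇒nonZero; prime⇒nonTrivial)
open import Data.Nat.Properties as ℕ using (allUpTo?; anyUpTo?)
open import Data.Product using (Σ; _×_; _,_; proj₁; proj₂; ∃; ∃₂; ∃-syntax)
open import Data.Rational as ℚ using (ℚ; 0ℚ; _/_; mkℚ; ↥_; ↧ₙ_)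
import Data.Rational.Properties as ℚ
import Data.Rational.Unnormalised as ℚᵘ
import Data.Rational.Unnormalised.Properties as ℚᵘ
open import Data.Sum using (_⊎_; inj₁; inj₂; [_,_]′)
open import Function using (_∘_; _$_; _⇔_; mk⇔)
open import Induction.WellFounded using (Acc; acc)
open import Relation.Binary.Definitions using (tri<; tri≈; tri>)
open import Relation.Binary.PropositionalEquality
  using (_≡_; _≢_; refl; sym; trans; cong; cong₂; subst; ≢-sym; module ≡-Reasoning)
open import Relation.Nullary using (¬_; Dec; yes; no; contradiction)
open import Relation.Nullary.Decidable as Dec using (¬?; _×-dec_; _→-dec_; toWitness; decidable-stable)
open import Relation.Unary using (Decidable)

-- Finite sums ∑_{i ≤ k}

module Sum {c ℓ} (R : Semiring c ℓ) where

  open Semiring R hiding (refl; sym; trans)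
  open Semiring R using () renaming (refl to ≈-refl)
  open import Relation.Binary.Reasoning.Setoid setoid

  ∑≤ : ℕ → (ℕ → Carrier) → Carrier
  ∑≤ zero    t = t 0
  ∑≤ (suc k) t = ∑≤ k t + t (suc k)

  infix 5 ∑≤
  syntax ∑≤ k (λ i → t) = ∑[ i ≤ k ] t

  ∑-cong : ∀ k {t u} → (∀ {i} → i ≤ k → t i ≈ u i) → ∑≤ k t ≈ ∑≤ k u
  ∑-cong zero    t≈u = t≈u z≤n
  ∑-cong (suc k) t≈u = +-cong (∑-cong k (t≈u ∘ ℕ.m≤n⇒m≤1+n)) (t≈u ℕ.≤-refl)

  ∑-zero : ∀ k {t} → (∀ {i} → i ≤ k → t i ≈ 0#) → ∑≤ k t ≈ 0#
  ∑-zero zero    t≈0 = t≈0 z≤n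
  ∑-zero (suc k) t≈0 = begin
    ∑≤ k _ + _ ≈⟨ +-cong (∑-zero k (t≈0 ∘ ℕ.m≤n⇒m≤1+n)) (t≈0 ℕ.≤-refl) ⟩
    0# + 0#    ≈⟨ +-identityˡ 0# ⟩
    0#         ∎

  ∑-single : ∀ k {m t} → m ≤ k → (∀ {i} → i ≤ k → i ≢ m → t i ≈ 0#) → ∑≤ k t ≈ t m
  ∑-single zero    z≤n _ = ≈-refl
  ∑-single (suc k) {m} {t} m≤1+k others with ℕ.m≤n⇒m<n∨m≡n m≤1+k
  ... | inj₁ m<1+k = begin
    ∑≤ k t + t (suc k) ≈⟨ +-cong (∑-single k (ℕ.≤-pred m<1+k) (others ∘ ℕ.m≤n⇒m≤1+n))
                                 (others ℕ.≤-refl (ℕ.>⇒≢ m<1+k)) ⟩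
    t m + 0#           ≈⟨ +-identityʳ (t m) ⟩
    t m                ∎
  ... | inj₂ refl = begin
    ∑≤ k t + t (suc k) ≈⟨ +-cong (∑-zero k (λ i≤k → others (ℕ.m≤n⇒m≤1+n i≤k) (ℕ.<⇒≢ (s≤s i≤k)))) ≈-refl ⟩
    0# + t (suc k)     ≈⟨ +-identityˡ (t (suc k)) ⟩
    t (suc k)          ∎

  *-distribˡ-∑ : ∀ x k t → x * ∑≤ k t ≈ ∑[ i ≤ k ] x * t i
  *-distribˡ-∑ x zero    t = ≈-refl
  *-distribˡ-∑ x (suc k) t = begin
    x * (∑≤ k t + t (suc k))          ≈⟨ distribˡ x (∑≤ k t) (t (suc k)) ⟩
    x * ∑≤ k t + x * t (suc k)        ≈⟨ +-congʳ (*-distribˡ-∑ x k t) ⟩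
    (∑[ i ≤ k ] x * t i) + x * t (suc k) ∎

  ∑-suc : ∀ k t → ∑≤ (suc k) t ≈ t 0 + (∑[ i ≤ k ] t (suc i))
  ∑-suc zero    t = ≈-refl
  ∑-suc (suc k) t = begin
    ∑≤ (suc k) t + t (suc (suc k))                 ≈⟨ +-congʳ (∑-suc k t) ⟩
    t 0 + (∑[ i ≤ k ] t (suc i)) + t (suc (suc k)) ≈⟨ +-assoc (t 0) _ _ ⟩
    t 0 + (∑[ i ≤ suc k ] t (suc i))               ∎

-- Opened only here: inside Sum they would clash with the semiring's operators.
open import Data.Integer.Base using (_+_; _*_)
open Sum ℤ.+-*-semiring

module _ {m : ℤ} where

  ∑-∣ : ∀ k {t} → (∀ {i} → i ≤ k → m ∣ t i) → m ∣ ∑≤ k t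
  ∑-∣ zero    m∣t = m∣t z≤n
  ∑-∣ (suc k) m∣t = ∣m∣n⇒∣m+n (∑-∣ k (m∣t ∘ ℕ.m≤n⇒m≤1+n)) (m∣t ℕ.≤-refl)

  ∑-∤ : ∀ k {j t} → j ≤ k → ¬ m ∣ t j → (∀ {i} → i ≤ k → i ≢ j → m ∣ t i) → ¬ m ∣ ∑≤ k t
  ∑-∤ zero    z≤n m∤tj _ = m∤tj
  ∑-∤ (suc k) {j} j≤1+k m∤tj others m∣∑ with ℕ.m≤n⇒m<n∨m≡n j≤1+k
  ... | inj₁ j<1+k = ∑-∤ k (ℕ.≤-pred j<1+k) m∤tj (others ∘ ℕ.m≤n⇒m≤1+n)
                        (∣m+n∣n⇒∣m m∣∑ (others ℕ.≤-refl (ℕ.>⇒≢ j<1+k)))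
  ... | inj₂ refl = m∤tj (∣m+n∣m⇒∣n m∣∑ (∑-∣ k (λ i≤k → others (ℕ.m≤n⇒m≤1+n i≤k) (ℕ.<⇒≢ (s≤s i≤k)))))

module _ {p : ℕ} (p-prime : Prime p) where

  private instance
    p-nonZero : ℕ.NonZero p
    p-nonZero = prime⇒nonZero p-prime

  ∣*⇒∣∨∣ : ∀ x y → + p ∣ x * y → + p ∣ x ⊎ + p ∣ y
  ∣*⇒∣∨∣ x y p∣xy with euclidsLemma ℤ.∣ x ∣ ℤ.∣ y ∣ p-prime (subst (p ℕ.∣_) (ℤ.abs-* x y) (∣⇒∣ᵤ p∣xy))
  ... | inj₁ p∣x = inj₁ (∣ᵤ⇒∣ p∣x)
  ... | inj₂ p∣y = inj₂ (∣ᵤ⇒∣ p∣y)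

  ∤*∤⇒∤* : ∀ {x y} → ¬ + p ∣ x → ¬ + p ∣ y → ¬ + p ∣ x * y
  ∤*∤⇒∤* {x} {y} p∤x p∤y p∣xy = [ p∤x , p∤y ]′ (∣*⇒∣∨∣ x y p∣xy)

  -- Euclid gives x = r p; then p ∣ u r after cancelling p from p² ∣ u r p, so p ∣ r.
  ²∣*⇒²∣ : ∀ u x → ¬ + p ∣ u → + p * + p ∣ u * x → + p * + p ∣ x
  ²∣*⇒²∣ u x p∤u p²∣ux with ∣*⇒∣∨∣ u x (∣-trans (∣m⇒∣m*n (+ p) ∣-refl) p²∣ux)
  ... | inj₁ p∣u = contradiction p∣u p∤u
  ... | inj₂ (divides r refl) with ∣*⇒∣∨∣ u r (*-cancelʳ-∣ (+ p) (subst (+ p * + p ∣_) (sym (ℤ.*-assoc u r (+ p))) p²∣ux))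
  ...   | inj₁ p∣u = contradiction p∣u p∤u
  ...   | inj₂ p∣r = *-monoˡ-∣ (+ p) p∣r

∣∧∣⇒²∣* : ∀ {k x y} → k ∣ x → k ∣ y → k * k ∣ x * y
∣∧∣⇒²∣* {k} {x} k∣x k∣y = ∣-trans (*-monoˡ-∣ k k∣x) (*-monoʳ-∣ x k∣y)

-- Integer polynomials as coefficient sequences

_VanishesAbove_ : (ℕ → ℤ) → ℕ → Set
G VanishesAbove d = ∀ {i} → d < i → G i ≡ 0ℤ

_HasDegree_ : (ℕ → ℤ) → ℕ → Set
G HasDegree d = G d ≢ 0ℤ × G VanishesAbove d

infixl 7 _✶_
_✶_ : (ℕ → ℤ) → (ℕ → ℤ) → ℕ → ℤ
(G ✶ H) k = ∑[ i ≤ k ] G i * H (k ∸ i)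

private
  k<a+b⇒k∸i<b : ∀ a b {i k} → a ≤ i → i ≤ k → k < a ℕ.+ b → k ∸ i < b
  k<a+b⇒k∸i<b zero    b {i} {k} _         _         k<b        = ℕ.≤-<-trans (ℕ.m∸n≤m k i) k<b
  k<a+b⇒k∸i<b (suc a) b         (s≤s a≤i) (s≤s i≤k) (s≤s k<ab) = k<a+b⇒k∸i<b a b a≤i i≤k k<ab

  a+b<k⇒b<k∸i : ∀ a b {i k} → i ≤ a → a ℕ.+ b < k → b < k ∸ i
  a+b<k⇒b<k∸i a       b {zero}          _         ab<k       = ℕ.≤-<-trans (ℕ.m≤n+m b a) ab<k
  a+b<k⇒b<k∸i (suc a) b {suc i} {suc k} (s≤s i≤a) (s≤s ab<k) = a+b<k⇒b<k∸i a b i≤a ab<k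

  a<i⇒a+b∸i<b : ∀ a b {i} → a < i → i ≤ a ℕ.+ b → a ℕ.+ b ∸ i < b
  a<i⇒a+b∸i<b a b a<i i≤ab = k<a+b⇒k∸i<b (suc a) b a<i i≤ab ℕ.≤-refl

  i<a⇒b<a+b∸i : ∀ a b {i} → i < a → b < a ℕ.+ b ∸ i
  i<a⇒b<a+b∸i (suc a) b (s≤s i≤a) = a+b<k⇒b<k∸i a b i≤a ℕ.≤-refl

  ≢∧≮⇒> : ∀ {a i} → i ≢ a → ¬ i < a → a < i
  ≢∧≮⇒> i≢a i≮a = ℕ.≤∧≢⇒< (ℕ.≮⇒≥ i≮a) (≢-sym i≢a)

module _ {G H : ℕ → ℤ} {d e : ℕ} (G-vanishes : G VanishesAbove d) (H-vanishes : H VanishesAbove e) where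

  private
    term-vanishes : ∀ {i k} → d < i ⊎ e < k ∸ i → G i * H (k ∸ i) ≡ 0ℤ
    term-vanishes {i} (inj₁ d<i) rewrite G-vanishes d<i = refl
    term-vanishes {i} (inj₂ e<k∸i) rewrite H-vanishes e<k∸i = ℤ.*-zeroʳ (G i)

  ✶-vanishesAbove : (G ✶ H) VanishesAbove (d ℕ.+ e)
  ✶-vanishesAbove {k} de<k = ∑-zero k λ {i} _ → term-vanishes (split i)
    where
    split : ∀ i → d < i ⊎ e < k ∸ i
    split i with d <? i
    ... | yes d<i = inj₁ d<i
    ... | no  d≮i = inj₂ (a+b<k⇒b<k∸i d e (ℕ.≮⇒≥ d≮i) de<k)

  ✶-leading : (G ✶ H) (d ℕ.+ e) ≡ G d * H e
  ✶-leading = begin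
    (G ✶ H) (d ℕ.+ e)        ≡⟨ ∑-single (d ℕ.+ e) (ℕ.m≤m+n d e) (λ {i} _ i≢d → term-vanishes (split i i≢d)) ⟩
    G d * H (d ℕ.+ e ∸ d)    ≡⟨ cong (λ k → G d * H k) (ℕ.m+n∸m≡n d e) ⟩
    G d * H e                ∎
    where
    open ≡-Reasoning
    split : ∀ i → i ≢ d → d < i ⊎ e < d ℕ.+ e ∸ i
    split i i≢d with i <? d
    ... | yes i<d = inj₂ (i<a⇒b<a+b∸i d e i<d)
    ... | no  i≮d = inj₁ (≢∧≮⇒> i≢d i≮d)

module _ {P : ℕ → Set} (P? : Decidable P) where

  private
    first-failure : ∀ m → (∀ {k} → k < m → P k) ⊎ ∃[ a ] (∀ {k} → k < a → P k) × ¬ P a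
    first-failure zero = inj₁ λ ()
    first-failure (suc m) with first-failure m | P? m
    ... | inj₂ found | _      = inj₂ found
    ... | inj₁ below | no ¬Pm = inj₂ (m , below , ¬Pm)
    ... | inj₁ below | yes Pm = inj₁ λ k<1+m → [ below , (λ where refl → Pm) ]′ (ℕ.m<1+n⇒m<n∨m≡n k<1+m)

  least-counterexample : ∀ {i} → ¬ P i → ∃[ a ] (∀ {k} → k < a → P k) × ¬ P a
  least-counterexample {i} ¬Pi = [ (λ below → contradiction (below ℕ.≤-refl) ¬Pi) , (λ found → found) ]′ (first-failure (suc i))

  all-or-counterexample : ∀ m → (∀ {k} → m < k → P k) → (∀ k → P k) ⊎ ∃ λ i → ¬ P i
  all-or-counterexample m above with anyUpTo? (¬? ∘ P?) (suc m)
  ... | yes (i , _ , ¬Pi) = inj₂ (i , ¬Pi)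
  ... | no  none          = inj₁ all
    where
    all : ∀ k → P k
    all k with k ≤? m
    ... | yes k≤m = decidable-stable (P? k) λ ¬Pk → none (k , s≤s k≤m , ¬Pk)
    ... | no  k≰m = above (ℕ.≰⇒> k≰m)

  greatest-counterexample : ∀ m → (∀ {k} → m ≤ k → P k) → ∀ {i} → ¬ P i → ∃[ a ] (∀ {k} → a < k → P k) × ¬ P a
  greatest-counterexample zero    above ¬Pi = contradiction (above z≤n) ¬Pi
  greatest-counterexample (suc m) above ¬Pi with P? m
  ... | no  ¬Pm = m , above , ¬Pm
  ... | yes Pm  = greatest-counterexample m (λ m≤k → [ above , (λ where refl → Pm) ]′ (ℕ.m≤n⇒m<n∨m≡n m≤k)) ¬Pi

≡0⇒∣ : ∀ {k x} → x ≡ 0ℤ → k ∣ x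
≡0⇒∣ refl = divides 0ℤ refl

∣-all-or-∤ : ∀ {p G d} → G VanishesAbove d → (∀ i → + p ∣ G i) ⊎ ∃ λ i → ¬ + p ∣ G i
∣-all-or-∤ {p} {G} {d} G-vanishes = all-or-counterexample (λ i → + p ∣? G i) d (≡0⇒∣ ∘ G-vanishes)

degree-or-zero : ∀ {G L} → G VanishesAbove L → (∃ λ d → G HasDegree d) ⊎ (∀ i → G i ≡ 0ℤ)
degree-or-zero {G} {L} G-vanishes with all-or-counterexample (λ i → G i ℤ.≟ 0ℤ) L G-vanishes
... | inj₁ G≡0 = inj₂ G≡0
... | inj₂ (_ , Gi≢0) with greatest-counterexample (λ i → G i ℤ.≟ 0ℤ) (suc L) G-vanishes Gi≢0
...   | d , above , Gd≢0 = inj₁ (d , Gd≢0 , above)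

-- Reduction modulo a prime

OrderMod DegreeMod : ℕ → (ℕ → ℤ) → ℕ → Set
OrderMod  p G a = (∀ {i} → i < a → + p ∣ G i) × ¬ + p ∣ G a
DegreeMod p G a = (∀ {i} → a < i → + p ∣ G i) × ¬ + p ∣ G a

MonomialMod : ℕ → (ℕ → ℤ) → ℕ → Set
MonomialMod p G a = (∀ {i} → i ≢ a → + p ∣ G i) × ¬ + p ∣ G a

module _ {p : ℕ} {G : ℕ → ℤ} where

  orderMod-exists : ∀ {i} → ¬ + p ∣ G i → ∃ (OrderMod p G)
  orderMod-exists = least-counterexample (λ i → + p ∣? G i)

  degreeMod-exists : ∀ {d i} → G VanishesAbove d → ¬ + p ∣ G i → ∃ (DegreeMod p G)
  degreeMod-exists {d} G-vanishes = greatest-counterexample (λ i → + p ∣? G i) (suc d) (≡0⇒∣ ∘ G-vanishes)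

  orderMod-unique : ∀ {a b} → OrderMod p G a → OrderMod p G b → a ≡ b
  orderMod-unique {a} {b} (below-a , p∤Ga) (below-b , p∤Gb) with ℕ.<-cmp a b
  ... | tri< a<b _ _ = contradiction (below-b a<b) p∤Ga
  ... | tri≈ _ a≡b _ = a≡b
  ... | tri> _ _ b<a = contradiction (below-a b<a) p∤Gb

  degreeMod-unique : ∀ {a b} → DegreeMod p G a → DegreeMod p G b → a ≡ b
  degreeMod-unique {a} {b} (above-a , p∤Ga) (above-b , p∤Gb) with ℕ.<-cmp a b
  ... | tri< a<b _ _ = contradiction (above-a a<b) p∤Gb
  ... | tri≈ _ a≡b _ = a≡b
  ... | tri> _ _ b<a = contradiction (above-b b<a) p∤Ga

  orderMod≤degreeMod : ∀ {a b} → OrderMod p G a → DegreeMod p G b → a ≤ b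
  orderMod≤degreeMod (below , _) (_ , p∤Gb) = ℕ.≮⇒≥ (λ b<a → p∤Gb (below b<a))

  monomialMod⇒orderMod : ∀ {a} → MonomialMod p G a → OrderMod p G a
  monomialMod⇒orderMod (others , p∤Ga) = others ∘ ℕ.<⇒≢ , p∤Ga

  orderMod∧degreeMod⇒monomialMod : ∀ {a} → OrderMod p G a → DegreeMod p G a → MonomialMod p G a
  orderMod∧degreeMod⇒monomialMod {a} (below , p∤Ga) (above , _) = others , p∤Ga
    where
    others : ∀ {i} → i ≢ a → + p ∣ G i
    others {i} i≢a with i <? a
    ... | yes i<a = below i<a
    ... | no  i≮a = above (≢∧≮⇒> i≢a i≮a)

  monomialMod⇒degreeMod : ∀ {a} → MonomialMod p G a → DegreeMod p G a
  monomialMod⇒degreeMod (others , p∤Ga) = others ∘ ℕ.>⇒≢ , p∤Ga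

module _ {p : ℕ} (p-prime : Prime p) {G H : ℕ → ℤ} where

  private
    p∤✶ : ∀ {a b} → ¬ + p ∣ G a → ¬ + p ∣ H b →
          (∀ {i} → i ≤ a ℕ.+ b → i ≢ a → + p ∣ G i * H (a ℕ.+ b ∸ i)) → ¬ + p ∣ (G ✶ H) (a ℕ.+ b)
    p∤✶ {a} {b} p∤Ga p∤Hb = ∑-∤ (a ℕ.+ b) (ℕ.m≤m+n a b)
      (subst (λ k → ¬ + p ∣ G a * H k) (sym (ℕ.m+n∸m≡n a b)) (∤*∤⇒∤* p-prime p∤Ga p∤Hb))

  ✶-orderMod : ∀ {a b} → OrderMod p G a → OrderMod p H b → OrderMod p (G ✶ H) (a ℕ.+ b)
  ✶-orderMod {a} {b} (G-below , p∤Ga) (H-below , p∤Hb) =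
    below , p∤✶ p∤Ga p∤Hb (λ i≤ab i≢a → p∣term λ a≤i → a<i⇒a+b∸i<b a b (ℕ.≤∧≢⇒< a≤i (≢-sym i≢a)) i≤ab)
    where
    p∣term : ∀ {k i} → (a ≤ i → k ∸ i < b) → + p ∣ G i * H (k ∸ i)
    p∣term {k} {i} complement with i <? a
    ... | yes i<a = ∣m⇒∣m*n (H (k ∸ i)) (G-below i<a)
    ... | no  i≮a = ∣n⇒∣m*n (G i) (H-below (complement (ℕ.≮⇒≥ i≮a)))

    below : ∀ {k} → k < a ℕ.+ b → + p ∣ (G ✶ H) k
    below {k} k<ab = ∑-∣ k λ i≤k → p∣term λ a≤i → k<a+b⇒k∸i<b a b a≤i i≤k k<ab

  ✶-degreeMod : ∀ {a b} → DegreeMod p G a → DegreeMod p H b → DegreeMod p (G ✶ H) (a ℕ.+ b)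
  ✶-degreeMod {a} {b} (G-above , p∤Ga) (H-above , p∤Hb) =
    above , p∤✶ p∤Ga p∤Hb (λ _ i≢a → p∣term λ i≤a → i<a⇒b<a+b∸i a b (ℕ.≤∧≢⇒< i≤a i≢a))
    where
    p∣term : ∀ {k i} → (i ≤ a → b < k ∸ i) → + p ∣ G i * H (k ∸ i)
    p∣term {k} {i} complement with a <? i
    ... | yes a<i = ∣m⇒∣m*n (H (k ∸ i)) (G-above a<i)
    ... | no  a≮i = ∣n⇒∣m*n (G i) (H-above (complement (ℕ.≮⇒≥ a≮i)))

    above : ∀ {k} → a ℕ.+ b < k → + p ∣ (G ✶ H) k
    above {k} ab<k = ∑-∣ k λ _ → p∣term λ i≤a → a+b<k⇒b<k∸i a b i≤a ab<k

private
  +-≤-≡ : ∀ {a a′ b b′} → a ≤ a′ → b ≤ b′ → a ℕ.+ b ≡ a′ ℕ.+ b′ → a ≡ a′ × b ≡ b′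
  +-≤-≡ {a} a≤a′ b≤b′ eq with ℕ.m≤n⇒m<n∨m≡n a≤a′
  ... | inj₁ a<a′ = contradiction eq (ℕ.<⇒≢ (ℕ.+-mono-<-≤ a<a′ b≤b′))
  ... | inj₂ refl = refl , ℕ.+-cancelˡ-≡ a _ _ eq

-- Orders and degrees add in the domain 𝔽ₚ[x], so only monomials divide a monomial.
monomialMod-factors : ∀ {p} → Prime p → ∀ {G H d e i₁ i₂ j} → G VanishesAbove d → H VanishesAbove e →
                      ¬ + p ∣ G i₁ → ¬ + p ∣ H i₂ → MonomialMod p (G ✶ H) j →
                      ∃₂ λ a b → a ℕ.+ b ≡ j × MonomialMod p G a × MonomialMod p H b
monomialMod-factors p-prime G-vanishes H-vanishes p∤G p∤H GH-monomial
  with orderMod-exists p∤G | orderMod-exists p∤H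
     | degreeMod-exists G-vanishes p∤G | degreeMod-exists H-vanishes p∤H
... | a , G-order | b , H-order | a′ , G-degree | b′ , H-degree
  with orderMod-unique (✶-orderMod p-prime G-order H-order) (monomialMod⇒orderMod GH-monomial)
     | degreeMod-unique (✶-degreeMod p-prime G-degree H-degree) (monomialMod⇒degreeMod GH-monomial)
... | a+b≡j | a′+b′≡j
  with +-≤-≡ (orderMod≤degreeMod G-order G-degree) (orderMod≤degreeMod H-order H-degree) (trans a+b≡j (sym a′+b′≡j))
... | refl , refl =
  a , b , a+b≡j , orderMod∧degreeMod⇒monomialMod G-order G-degree , orderMod∧degreeMod⇒monomialMod H-order H-degree

monomialMod-resp : ∀ {p X Y a} → (∀ k → X k ≡ Y k) → MonomialMod p X a → MonomialMod p Y a
monomialMod-resp {p} X≗Y (others , p∤Xa) =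
  (λ {i} i≢a → subst (+ p ∣_) (X≗Y i) (others i≢a)) , (p∤Xa ∘ subst (+ p ∣_) (sym (X≗Y _)))

-- For j = N this is Eisenstein's criterion at p.
record EisensteinAt (p N j : ℕ) (φ : ℕ → ℤ) : Set where
  field
    monomialMod : MonomialMod p φ j
    low         : j ≢ 0 → ¬ + p * + p ∣ φ 0
    high        : j ≢ N → ¬ + p * + p ∣ φ N

eisensteinAt-scale : ∀ {p N j φ} → Prime p → (u : ℕ → ℤ) → (∀ k → ¬ + p ∣ u k) →
                     EisensteinAt p N j φ → EisensteinAt p N j (λ k → u k * φ k)
eisensteinAt-scale {N = N} {φ = φ} p-prime u p∤u eis = record
  { monomialMod = (λ {i} i≢j → ∣n⇒∣m*n (u i) (others i≢j)) , ∤*∤⇒∤* p-prime (p∤u _) p∤φj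
  ; low         = λ j≢0 → low j≢0 ∘ ²∣*⇒²∣ p-prime (u 0) (φ 0) (p∤u 0)
  ; high        = λ j≢N → high j≢N ∘ ²∣*⇒²∣ p-prime (u N) (φ N) (p∤u N)
  }
  where
  open EisensteinAt eis
  others = proj₁ monomialMod
  p∤φj = proj₂ monomialMod

module _ {p N j : ℕ} {ψ : ℕ → ℤ} (eis : EisensteinAt p N j ψ) where

  open EisensteinAt eis

  -- Otherwise p divides X x and Y y, so p² ∣ ψ N; or j = N > y and Y j = 0.
  unit-factor-degree : ∀ {X Y : ℕ → ℤ} {x y} → ψ N ≡ X x * Y y → x ℕ.+ y ≡ N → 1 ≤ x →
                       Y VanishesAbove y → MonomialMod p X 0 → MonomialMod p Y j → y ≡ j
  unit-factor-degree {X} {Y} {x} {y} ψN≡XxYy x+y≡N 1≤x Y-vanishes (X-others , _) (Y-others , p∤Yj) with y ℕ.≟ j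
  ... | yes y≡j = y≡j
  ... | no  y≢j with j ℕ.≟ N
  ...   | no  j≢N = contradiction (subst (+ p * + p ∣_) (sym ψN≡XxYy) (∣∧∣⇒²∣* (X-others (ℕ.>⇒≢ 1≤x)) (Y-others y≢j))) (high j≢N)
  ...   | yes refl = contradiction (≡0⇒∣ (Y-vanishes (subst (y <_) x+y≡N (ℕ.m<n+m y 1≤x)))) p∤Yj

  nonunit-factors : ∀ {X Y : ℕ → ℤ} {a b} → ψ 0 ≡ X 0 * Y 0 → a ℕ.+ b ≡ j → a ≢ 0 → b ≢ 0 →
                    ¬ (MonomialMod p X a × MonomialMod p Y b)
  nonunit-factors ψ0≡X0Y0 a+b≡j a≢0 b≢0 ((X-others , _) , (Y-others , _)) =
    low (λ j≡0 → a≢0 (ℕ.m+n≡0⇒m≡0 _ (trans a+b≡j j≡0)))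
        (subst (+ p * + p ∣_) (sym ψ0≡X0Y0) (∣∧∣⇒²∣* (X-others (≢-sym a≢0)) (Y-others (≢-sym b≢0))))

-- Factorisations over ℤ and Gauss's lemma

record Factorisation (φ : ℕ → ℤ) (d e : ℕ) : Set where
  field
    scale        : ℤ
    scale≢0      : scale ≢ 0ℤ
    left right   : ℕ → ℤ
    left-degree  : left HasDegree d
    right-degree : right HasDegree e
    factorises   : ∀ k → scale * φ k ≡ (left ✶ right) k

PrimitiveAt : ∀ {φ d e} → ℕ → Factorisation φ d e → Set
PrimitiveAt p fac = (∃ λ i → ¬ + p ∣ left i) × (∃ λ i → ¬ + p ∣ right i)
  where open Factorisation fac

private
  swapˡ : ∀ g x h → g * x * h ≡ x * (g * h)
  swapˡ = solve-∀

  swapʳ : ∀ g h x → g * (h * x) ≡ x * (g * h)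
  swapʳ = solve-∀

✶-scaleˡ : ∀ {G} G′ H x → (∀ i → G i ≡ G′ i * x) → ∀ k → (G ✶ H) k ≡ x * (G′ ✶ H) k
✶-scaleˡ {G} G′ H x G≡G′x k = begin
  (G ✶ H) k                          ≡⟨ ∑-cong k (λ {i} _ → cong (_* H (k ∸ i)) (G≡G′x i)) ⟩
  ∑[ i ≤ k ] G′ i * x * H (k ∸ i)    ≡⟨ ∑-cong k (λ {i} _ → swapˡ (G′ i) x (H (k ∸ i))) ⟩
  ∑[ i ≤ k ] x * (G′ i * H (k ∸ i))  ≡⟨ *-distribˡ-∑ x k _ ⟨
  x * (G′ ✶ H) k                     ∎
  where open ≡-Reasoning

✶-scaleʳ : ∀ G {H} H′ x → (∀ i → H i ≡ H′ i * x) → ∀ k → (G ✶ H) k ≡ x * (G ✶ H′) k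
✶-scaleʳ G {H} H′ x H≡H′x k = begin
  (G ✶ H) k                           ≡⟨ ∑-cong k (λ {i} _ → cong (G i *_) (H≡H′x (k ∸ i))) ⟩
  ∑[ i ≤ k ] G i * (H′ (k ∸ i) * x)   ≡⟨ ∑-cong k (λ {i} _ → swapʳ (G i) (H′ (k ∸ i)) x) ⟩
  ∑[ i ≤ k ] x * (G i * H′ (k ∸ i))   ≡⟨ *-distribˡ-∑ x k _ ⟨
  x * (G ✶ H′) k                      ∎
  where open ≡-Reasoning

hasDegree-÷ : ∀ {G d} G′ {x} → x ≢ 0ℤ → (∀ i → G i ≡ G′ i * x) → G HasDegree d → G′ HasDegree d
hasDegree-÷ {d = d} G′ {x} x≢0 G≡G′x (Gd≢0 , G-vanishes) =
  (λ G′d≡0 → Gd≢0 (trans (G≡G′x d) (cong (_* x) G′d≡0))) ,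
  (λ {i} d<i → [ (λ G′i≡0 → G′i≡0) , (λ x≡0 → contradiction x≡0 x≢0) ]′
                 (ℤ.i*j≡0⇒i≡0∨j≡0 (G′ i) (trans (sym (G≡G′x i)) (G-vanishes d<i))))

module _ {p : ℕ} (p-prime : Prime p) {φ : ℕ → ℤ} {j : ℕ} (p∤φj : ¬ + p ∣ φ j) {d e : ℕ} where

  open Factorisation

  private
    instance
      p-nonZero : ℕ.NonZero p
      p-nonZero = prime⇒nonZero p-prime
      p-nonTrivial : ℕ.NonTrivial p
      p-nonTrivial = prime⇒nonTrivial p-prime

    p≢0 : + p ≢ 0ℤ
    p≢0 p≡0 = ℕ.≢-nonZero⁻¹ p (cong ℤ.∣_∣ p≡0)

    regroup : ∀ q m φk → q * (m * φk) ≡ m * q * φk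
    regroup = solve-∀

    -- p ∤ φ j, so p ∣ M φ j forces p ∣ M
    divide-scale : ∀ {M : ℤ} {X : ℕ → ℤ} → M ≢ 0ℤ → (∀ k → M * φ k ≡ + p * X k) →
                   ∃[ M′ ] M′ ≢ 0ℤ × ℤ.∣ M′ ∣ < ℤ.∣ M ∣ × (∀ k → M′ * φ k ≡ X k)
    divide-scale {M} {X} M≢0 M*φ≡p*X with ∣*⇒∣∨∣ p-prime M (φ j) (divides (X j) (trans (M*φ≡p*X j) (ℤ.*-comm (+ p) (X j))))
    ... | inj₂ p∣φj = contradiction p∣φj p∤φj
    ... | inj₁ (divides M′ refl) =
      M′ , M′≢0 , |M′|<|M′p| , λ k → ℤ.*-cancelˡ-≡ (+ p) _ _ (trans (regroup (+ p) M′ (φ k)) (M*φ≡p*X k))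
      where
      M′≢0 : M′ ≢ 0ℤ
      M′≢0 refl = M≢0 refl
      instance _ = ℕ.≢-nonZero (M′≢0 ∘ ℤ.∣i∣≡0⇒i≡0)
      |M′|<|M′p| : ℤ.∣ M′ ∣ < ℤ.∣ M′ * + p ∣
      |M′|<|M′p| = subst (ℤ.∣ M′ ∣ <_) (sym (ℤ.abs-* M′ (+ p))) (ℕ.m<m*n ℤ.∣ M′ ∣ p (ℕ.nonTrivial⇒n>1 p))

    Smaller : Factorisation φ d e → Set
    Smaller fac = Σ (Factorisation φ d e) λ fac′ → ℤ.∣ scale fac′ ∣ < ℤ.∣ scale fac ∣

    divide-out : (fac : Factorisation φ d e) → ∀ {G′ H′} → G′ HasDegree d → H′ HasDegree e →
                 (∀ k → (left fac ✶ right fac) k ≡ + p * (G′ ✶ H′) k) → Smaller fac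
    divide-out fac {G′} {H′} G′-degree H′-degree GH≡pG′H′
      with divide-scale (scale≢0 fac) (λ k → trans (factorises fac k) (GH≡pG′H′ k))
    ... | M′ , M′≢0 , |M′|<|M| , factorises′ = record
      { scale = M′ ; scale≢0 = M′≢0 ; left = G′ ; right = H′
      ; left-degree = G′-degree ; right-degree = H′-degree ; factorises = factorises′ } , |M′|<|M|

    divide-left : (fac : Factorisation φ d e) → (∀ i → + p ∣ left fac i) → Smaller fac
    divide-left fac p∣G = divide-out fac (hasDegree-÷ G′ p≢0 G≡G′p (left-degree fac)) (right-degree fac)
                                     (✶-scaleˡ G′ (right fac) (+ p) G≡G′p)
      where
      G′ = λ i → quotient (p∣G i)
      G≡G′p = λ i → _∣_.equality (p∣G i)

    divide-right : (fac : Factorisation φ d e) → (∀ i → + p ∣ right fac i) → Smaller fac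
    divide-right fac p∣H = divide-out fac (left-degree fac) (hasDegree-÷ H′ p≢0 H≡H′p (right-degree fac))
                                      (✶-scaleʳ (left fac) H′ (+ p) H≡H′p)
      where
      H′ = λ i → quotient (p∣H i)
      H≡H′p = λ i → _∣_.equality (p∣H i)

  private
    smaller-or-primitive : (fac : Factorisation φ d e) → Smaller fac ⊎ PrimitiveAt p fac
    smaller-or-primitive fac with ∣-all-or-∤ (proj₂ (left-degree fac)) | ∣-all-or-∤ (proj₂ (right-degree fac))
    ... | inj₁ p∣G | _        = inj₁ (divide-left fac p∣G)
    ... | inj₂ p∤G | inj₁ p∣H = inj₁ (divide-right fac p∣H)
    ... | inj₂ p∤G | inj₂ p∤H = inj₂ (p∤G , p∤H)

  -- Gauss's lemma: divide p out of a factor until neither factor is ≡ 0 mod p.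
  primitive-factorisation : Factorisation φ d e → Σ (Factorisation φ d e) (PrimitiveAt p)
  primitive-factorisation fac = go fac (ℕ.<-wellFounded ℤ.∣ scale fac ∣)
    where
    go : (fac : Factorisation φ d e) → Acc _<_ ℤ.∣ scale fac ∣ → Σ (Factorisation φ d e) (PrimitiveAt p)
    go fac (acc smaller) with smaller-or-primitive fac
    ... | inj₁ (fac′ , |M′|<|M|) = go fac′ (smaller |M′|<|M|)
    ... | inj₂ fac-primitive     = fac , fac-primitive

  primitive⇒p∤scale : (fac : Factorisation φ d e) → PrimitiveAt p fac → ¬ + p ∣ scale fac
  primitive⇒p∤scale fac ((_ , p∤G) , (_ , p∤H)) p∣M
    with orderMod-exists p∤G | orderMod-exists p∤H
  ... | a , G-order | b , H-order =
    proj₂ (✶-orderMod p-prime {left fac} {right fac} G-order H-order)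
          (subst (+ p ∣_) (factorises fac (a ℕ.+ b)) (∣m⇒∣m*n (φ (a ℕ.+ b)) p∣M))

module _ {φ : ℕ → ℤ} {d e : ℕ} (fac : Factorisation φ d e) where

  open Factorisation fac

  factorises-leading : scale * φ (d ℕ.+ e) ≡ left d * right e
  factorises-leading = trans (factorises (d ℕ.+ e)) (✶-leading (proj₂ left-degree) (proj₂ right-degree))

  factorisation-degree : ∀ {N} → φ HasDegree N → d ℕ.+ e ≡ N
  factorisation-degree {N} (φN≢0 , φ-vanishes) with ℕ.<-cmp (d ℕ.+ e) N
  ... | tri≈ _ d+e≡N _ = d+e≡N
  ... | tri< d+e<N _ _ = ⊥-elim $ [ scale≢0 , φN≢0 ]′ (ℤ.i*j≡0⇒i≡0∨j≡0 scale
          (trans (factorises N) (✶-vanishesAbove (proj₂ left-degree) (proj₂ right-degree) d+e<N)))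
  ... | tri> _ _ N<d+e = ⊥-elim $ [ proj₁ left-degree , proj₁ right-degree ]′ (ℤ.i*j≡0⇒i≡0∨j≡0 (left d)
          (trans (sym factorises-leading) (trans (cong (scale *_) (φ-vanishes N<d+e)) (ℤ.*-zeroʳ scale))))

module _ {p N j : ℕ} (p-prime : Prime p) {φ : ℕ → ℤ} (eis : EisensteinAt p N j φ) {d e : ℕ} where

  open Factorisation

  private
    module Primitive (fac : Factorisation φ d e) (fac-primitive : PrimitiveAt p fac) (d+e≡N : d ℕ.+ e ≡ N) where

      G-vanishes = proj₂ (left-degree fac)
      H-vanishes = proj₂ (right-degree fac)

      scaled : EisensteinAt p N j (λ k → scale fac * φ k)
      scaled = eisensteinAt-scale p-prime (λ _ → scale fac) (λ _ → primitive⇒p∤scale p-prime p∤φj fac fac-primitive) eis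
        where p∤φj = proj₂ (EisensteinAt.monomialMod eis)

      leading : scale fac * φ N ≡ left fac d * right fac e
      leading = subst (λ k → scale fac * φ k ≡ left fac d * right fac e) d+e≡N (factorises-leading fac)

      monomial-factors : ∃₂ λ a b → a ℕ.+ b ≡ j × MonomialMod p (left fac) a × MonomialMod p (right fac) b
      monomial-factors = monomialMod-factors p-prime G-vanishes H-vanishes (proj₂ (proj₁ fac-primitive)) (proj₂ (proj₂ fac-primitive))
                           (monomialMod-resp (factorises fac) (EisensteinAt.monomialMod scaled))

      factor-degree : 1 ≤ d → 1 ≤ e → d ≡ j ⊎ e ≡ j
      factor-degree 1≤d 1≤e with monomial-factors
      ... | a , b , a+b≡j , G-monomial , H-monomial with a ℕ.≟ 0 | b ℕ.≟ 0
      ... | yes refl | _        =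
        inj₂ (unit-factor-degree scaled leading d+e≡N 1≤d H-vanishes G-monomial (subst (MonomialMod p (right fac)) a+b≡j H-monomial))
      ... | no  _    | yes refl =
        inj₁ (unit-factor-degree scaled (trans leading (ℤ.*-comm (left fac d) (right fac e))) (trans (ℕ.+-comm e d) d+e≡N) 1≤e
                G-vanishes H-monomial (subst (MonomialMod p (left fac)) (trans (sym (ℕ.+-identityʳ a)) a+b≡j) G-monomial))
      ... | no  a≢0  | no  b≢0  = ⊥-elim (nonunit-factors scaled (factorises fac 0) a+b≡j a≢0 b≢0 (G-monomial , H-monomial))

  eisenstein-factor-degree : Factorisation φ d e → 1 ≤ d → 1 ≤ e → d ℕ.+ e ≡ N → d ≡ j ⊎ e ≡ j
  eisenstein-factor-degree fac₀ 1≤d 1≤e d+e≡N =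
    let fac , fac-primitive = primitive-factorisation p-prime (proj₂ (EisensteinAt.monomialMod eis)) fac₀
    in Primitive.factor-degree fac fac-primitive d+e≡N 1≤d 1≤e

-- From ℚ[x] to ℤ[x]

ι : ℤ → ℚ
ι z = z / 1

private
  toℚᵘ-ι : ∀ z → ℚ.toℚᵘ (ι z) ℚᵘ.≃ ℚᵘ.mkℚᵘ z 0
  toℚᵘ-ι z = ℚ.toℚᵘ-fromℚᵘ (ℚᵘ.mkℚᵘ z 0)

  +-over-1 : ∀ a b → (a + b) * + 1 ≡ (a * + 1 + b * + 1) * + 1
  +-over-1 = solve-∀

ι-homo-+ : ∀ a b → ι (a + b) ≡ ι a ℚ.+ ι b
ι-homo-+ a b = ℚ.toℚᵘ-injective (begin
  ℚ.toℚᵘ (ι (a + b))                ≈⟨ toℚᵘ-ι (a + b) ⟩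
  ℚᵘ.mkℚᵘ (a + b) 0                  ≈⟨ ℚᵘ.*≡* (+-over-1 a b) ⟩
  ℚᵘ.mkℚᵘ a 0 ℚᵘ.+ ℚᵘ.mkℚᵘ b 0       ≈⟨ ℚᵘ.+-cong (toℚᵘ-ι a) (toℚᵘ-ι b) ⟨
  ℚ.toℚᵘ (ι a) ℚᵘ.+ ℚ.toℚᵘ (ι b)     ≈⟨ ℚ.toℚᵘ-homo-+ (ι a) (ι b) ⟨
  ℚ.toℚᵘ (ι a ℚ.+ ι b)               ∎)
  where open ℚᵘ.≃-Reasoning

ι-homo-* : ∀ a b → ι (a * b) ≡ ι a ℚ.* ι b
ι-homo-* a b = ℚ.toℚᵘ-injective (begin
  ℚ.toℚᵘ (ι (a * b))                ≈⟨ toℚᵘ-ι (a * b) ⟩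
  ℚᵘ.mkℚᵘ a 0 ℚᵘ.* ℚᵘ.mkℚᵘ b 0       ≈⟨ ℚᵘ.*-cong (toℚᵘ-ι a) (toℚᵘ-ι b) ⟨
  ℚ.toℚᵘ (ι a) ℚᵘ.* ℚ.toℚᵘ (ι b)     ≈⟨ ℚ.toℚᵘ-homo-* (ι a) (ι b) ⟨
  ℚ.toℚᵘ (ι a ℚ.* ι b)               ∎)
  where open ℚᵘ.≃-Reasoning

ι-injective : ∀ {a b} → ι a ≡ ι b → a ≡ b
ι-injective {a} {b} ιa≡ιb with ℚᵘ.≃-trans (ℚᵘ.≃-sym (toℚᵘ-ι a)) (ℚᵘ.≃-trans (ℚᵘ.≃-reflexive (cong ℚ.toℚᵘ ιa≡ιb)) (toℚᵘ-ι b))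
... | ℚᵘ.*≡* a*1≡b*1 = trans (sym (ℤ.*-identityʳ a)) (trans a*1≡b*1 (ℤ.*-identityʳ b))

ι-↧*≡↥ : ∀ q → ι (+ ↧ₙ q) ℚ.* q ≡ ι (↥ q)
ι-↧*≡↥ q@(mkℚ n d-1 _) = ℚ.toℚᵘ-injective (begin
  ℚ.toℚᵘ (ι (+ ↧ₙ q) ℚ.* q)          ≈⟨ ℚ.toℚᵘ-homo-* (ι (+ ↧ₙ q)) q ⟩
  ℚ.toℚᵘ (ι (+ ↧ₙ q)) ℚᵘ.* ℚ.toℚᵘ q  ≈⟨ ℚᵘ.*-congʳ (toℚᵘ-ι (+ ↧ₙ q)) ⟩
  ℚᵘ.mkℚᵘ (+ ↧ₙ q) 0 ℚᵘ.* ℚᵘ.mkℚᵘ n d-1 ≈⟨ ℚᵘ.*≡* (cancel n (+ ↧ₙ q)) ⟩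
  ℚᵘ.mkℚᵘ n 0                       ≈⟨ toℚᵘ-ι n ⟨
  ℚ.toℚᵘ (ι n)                      ∎)
  where
  open ℚᵘ.≃-Reasoning
  cancel : ∀ n D → D * n * + 1 ≡ n * (+ 1 * D)
  cancel = solve-∀

module ℚ∑ = Sum (CommutativeRing.semiring ℚ.+-*-commutativeRing)
module ℚ* = CommutativeSemigroupProperties (CommutativeMonoid.commutativeSemigroup ℚ.*-1-commutativeMonoid)

ι-∑ : ∀ k t → ι (∑≤ k t) ≡ ℚ∑.∑≤ k (ι ∘ t)
ι-∑ zero    t = refl
ι-∑ (suc k) t = trans (ι-homo-+ (∑≤ k t) (t (suc k))) (cong (ℚ._+ ι (t (suc k))) (ι-∑ k t))

coeff-⊕ : ∀ f g k → coeff (f ⊕ g) k ≡ coeff f k ℚ.+ coeff g k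
coeff-⊕ []      g       k       = sym (ℚ.+-identityˡ (coeff g k))
coeff-⊕ (a ∷ f) []      k       = sym (ℚ.+-identityʳ (coeff (a ∷ f) k))
coeff-⊕ (a ∷ f) (b ∷ g) zero    = refl
coeff-⊕ (a ∷ f) (b ∷ g) (suc k) = coeff-⊕ f g k

coeff-map-* : ∀ a g k → coeff (map (a ℚ.*_) g) k ≡ a ℚ.* coeff g k
coeff-map-* a []      k       = sym (ℚ.*-zeroʳ a)
coeff-map-* a (b ∷ g) zero    = refl
coeff-map-* a (b ∷ g) (suc k) = coeff-map-* a g k

coeff-⊗ : ∀ f g k → coeff (f ⊗ g) k ≡ ℚ∑.∑≤ k (λ i → coeff f i ℚ.* coeff g (k ∸ i))
coeff-⊗ []      g k       = sym (ℚ∑.∑-zero k λ {i} _ → ℚ.*-zeroˡ (coeff g (k ∸ i)))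
coeff-⊗ (a ∷ f) g zero    = begin
  coeff (map (a ℚ.*_) g ⊕ (0ℚ ∷ f ⊗ g)) 0  ≡⟨ coeff-⊕ (map (a ℚ.*_) g) (0ℚ ∷ f ⊗ g) 0 ⟩
  coeff (map (a ℚ.*_) g) 0 ℚ.+ 0ℚ         ≡⟨ ℚ.+-identityʳ _ ⟩
  coeff (map (a ℚ.*_) g) 0                ≡⟨ coeff-map-* a g 0 ⟩
  a ℚ.* coeff g 0                         ∎
  where open ≡-Reasoning
coeff-⊗ (a ∷ f) g (suc k) = begin
  coeff (map (a ℚ.*_) g ⊕ (0ℚ ∷ f ⊗ g)) (suc k)
    ≡⟨ coeff-⊕ (map (a ℚ.*_) g) (0ℚ ∷ f ⊗ g) (suc k) ⟩
  coeff (map (a ℚ.*_) g) (suc k) ℚ.+ coeff (f ⊗ g) k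
    ≡⟨ cong₂ ℚ._+_ (coeff-map-* a g (suc k)) (coeff-⊗ f g k) ⟩
  a ℚ.* coeff g (suc k) ℚ.+ ℚ∑.∑≤ k (λ i → coeff f i ℚ.* coeff g (k ∸ i))
    ≡⟨ ℚ∑.∑-suc k (λ i → coeff (a ∷ f) i ℚ.* coeff g (suc k ∸ i)) ⟨
  ℚ∑.∑≤ (suc k) (λ i → coeff (a ∷ f) i ℚ.* coeff g (suc k ∸ i)) ∎
  where open ≡-Reasoning

denominator : Poly → ℕ
denominator []      = 1
denominator (q ∷ g) = ↧ₙ q ℕ.* denominator g

numerators : Poly → ℕ → ℤ
numerators []      _       = 0ℤ
numerators (q ∷ g) zero    = ↥ q * + denominator g
numerators (q ∷ g) (suc i) = + ↧ₙ q * numerators g i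

denominator-nonZero : ∀ g → ℕ.NonZero (denominator g)
denominator-nonZero []                 = _
denominator-nonZero (mkℚ _ d-1 _ ∷ g) = ℕ.m*n≢0 (suc d-1) (denominator g) {{_}} {{denominator-nonZero g}}

numerators-coeff : ∀ g i → ι (numerators g i) ≡ ι (+ denominator g) ℚ.* coeff g i
numerators-coeff []      i       = sym (ℚ.*-zeroʳ (ι (+ 1)))
numerators-coeff (q ∷ g) zero    = begin
  ι (↥ q * + D)                  ≡⟨ ι-homo-* (↥ q) (+ D) ⟩
  ι (↥ q) ℚ.* ι (+ D)            ≡⟨ cong (ℚ._* ι (+ D)) (ι-↧*≡↥ q) ⟨
  ι (+ ↧ₙ q) ℚ.* q ℚ.* ι (+ D)   ≡⟨ ℚ*.xy∙z≈xz∙y (ι (+ ↧ₙ q)) q (ι (+ D)) ⟩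
  ι (+ ↧ₙ q) ℚ.* ι (+ D) ℚ.* q   ≡⟨ cong (ℚ._* q) (ι-homo-* (+ ↧ₙ q) (+ D)) ⟨
  ι (+ ↧ₙ q * + D) ℚ.* q         ≡⟨ cong (λ z → ι z ℚ.* q) (ℤ.pos-* (↧ₙ q) D) ⟨
  ι (+ (↧ₙ q ℕ.* D)) ℚ.* q       ∎
  where
  open ≡-Reasoning
  D = denominator g
numerators-coeff (q ∷ g) (suc i) = begin
  ι (+ ↧ₙ q * numerators g i)                     ≡⟨ ι-homo-* (+ ↧ₙ q) (numerators g i) ⟩
  ι (+ ↧ₙ q) ℚ.* ι (numerators g i)               ≡⟨ cong (ι (+ ↧ₙ q) ℚ.*_) (numerators-coeff g i) ⟩
  ι (+ ↧ₙ q) ℚ.* (ι (+ D) ℚ.* coeff g i)          ≡⟨ ℚ.*-assoc (ι (+ ↧ₙ q)) (ι (+ D)) (coeff g i) ⟨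
  ι (+ ↧ₙ q) ℚ.* ι (+ D) ℚ.* coeff g i            ≡⟨ cong (ℚ._* coeff g i) (ι-homo-* (+ ↧ₙ q) (+ D)) ⟨
  ι (+ ↧ₙ q * + D) ℚ.* coeff g i                  ≡⟨ cong (λ z → ι z ℚ.* coeff g i) (ℤ.pos-* (↧ₙ q) D) ⟨
  ι (+ (↧ₙ q ℕ.* D)) ℚ.* coeff g i                ∎
  where
  open ≡-Reasoning
  D = denominator g

numerators-vanish : ∀ g → numerators g VanishesAbove length g
numerators-vanish []      _                 = refl
numerators-vanish (q ∷ g) {suc i} (s≤s g<i) rewrite numerators-vanish g g<i = ℤ.*-zeroʳ (+ ↧ₙ q)

numerators≡0⇒coeff≡0 : ∀ g i → numerators g i ≡ 0ℤ → coeff g i ≡ 0ℚ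
numerators≡0⇒coeff≡0 []      i       _ = refl
numerators≡0⇒coeff≡0 (q ∷ g) zero    N≡0 with ℤ.i*j≡0⇒i≡0∨j≡0 (↥ q) N≡0
... | inj₁ ↥q≡0 = ℚ.↥p≡0⇒p≡0 q ↥q≡0
... | inj₂ D≡0  = contradiction (cong ℤ.∣_∣ D≡0) (ℕ.≢-nonZero⁻¹ _ {{denominator-nonZero g}})
numerators≡0⇒coeff≡0 (mkℚ _ d-1 _ ∷ g) (suc i) N≡0 with ℤ.i*j≡0⇒i≡0∨j≡0 (+ suc d-1) N≡0
... | inj₂ N≡0′ = numerators≡0⇒coeff≡0 g i N≡0′

clear-denominators : ∀ g h k → ι (+ denominator g * + denominator h) ℚ.* coeff (g ⊗ h) k ≡ ι ((numerators g ✶ numerators h) k)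
clear-denominators g h k = begin
  ι (+ Dg * + Dh) ℚ.* coeff (g ⊗ h) k
    ≡⟨ cong₂ ℚ._*_ (ι-homo-* (+ Dg) (+ Dh)) (coeff-⊗ g h k) ⟩
  ι (+ Dg) ℚ.* ι (+ Dh) ℚ.* ℚ∑.∑≤ k (λ i → coeff g i ℚ.* coeff h (k ∸ i))
    ≡⟨ ℚ∑.*-distribˡ-∑ (ι (+ Dg) ℚ.* ι (+ Dh)) k _ ⟩
  ℚ∑.∑≤ k (λ i → ι (+ Dg) ℚ.* ι (+ Dh) ℚ.* (coeff g i ℚ.* coeff h (k ∸ i)))
    ≡⟨ ℚ∑.∑-cong k (λ {i} _ → ℚ*.interchange (ι (+ Dg)) (ι (+ Dh)) (coeff g i) (coeff h (k ∸ i))) ⟩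
  ℚ∑.∑≤ k (λ i → ι (+ Dg) ℚ.* coeff g i ℚ.* (ι (+ Dh) ℚ.* coeff h (k ∸ i)))
    ≡⟨ ℚ∑.∑-cong k (λ {i} _ → sym (cong₂ ℚ._*_ (numerators-coeff g i) (numerators-coeff h (k ∸ i)))) ⟩
  ℚ∑.∑≤ k (λ i → ι (numerators g i) ℚ.* ι (numerators h (k ∸ i)))
    ≡⟨ ℚ∑.∑-cong k (λ {i} _ → sym (ι-homo-* (numerators g i) (numerators h (k ∸ i)))) ⟩
  ℚ∑.∑≤ k (λ i → ι (numerators g i * numerators h (k ∸ i)))
    ≡⟨ ι-∑ k _ ⟨
  ι ((numerators g ✶ numerators h) k) ∎
  where
  open ≡-Reasoning
  Dg = denominator g
  Dh = denominator h

module _ {f : Poly} {φ : ℕ → ℤ} {N : ℕ} (f≗φ : ∀ k → coeff f k ≡ ι (φ k)) (φ-degree : φ HasDegree N) where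

  private
    integer-factorisation : ∀ g h → f ≈ₚ (g ⊗ h) →
                            ∀ k → + denominator g * + denominator h * φ k ≡ (numerators g ✶ numerators h) k
    integer-factorisation g h f≈gh k = ι-injective (begin
      ι (M * φ k)              ≡⟨ ι-homo-* M (φ k) ⟩
      ι M ℚ.* ι (φ k)          ≡⟨ cong (ι M ℚ.*_) (trans (sym (f≗φ k)) (f≈gh k)) ⟩
      ι M ℚ.* coeff (g ⊗ h) k  ≡⟨ clear-denominators g h k ⟩
      ι ((numerators g ✶ numerators h) k) ∎)
      where
      open ≡-Reasoning
      M = + denominator g * + denominator h

    M≢0 : ∀ g h → + denominator g * + denominator h ≢ 0ℤ
    M≢0 g h M≡0 with ℤ.i*j≡0⇒i≡0∨j≡0 (+ denominator g) M≡0
    ... | inj₁ Dg≡0 = ℕ.≢-nonZero⁻¹ _ {{denominator-nonZero g}} (cong ℤ.∣_∣ Dg≡0)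
    ... | inj₂ Dh≡0 = ℕ.≢-nonZero⁻¹ _ {{denominator-nonZero h}} (cong ℤ.∣_∣ Dh≡0)

    Mφ≢0 : ∀ g h → + denominator g * + denominator h * φ N ≢ 0ℤ
    Mφ≢0 g h = [ M≢0 g h , proj₁ φ-degree ]′ ∘ ℤ.i*j≡0⇒i≡0∨j≡0 _

  proper-factorisation : ∀ g h → f ≈ₚ (g ⊗ h) →
                         IsConstant g ⊎ IsConstant h ⊎ ∃₂ λ d e → 1 ≤ d × 1 ≤ e × Factorisation φ d e
  proper-factorisation g h f≈gh
    with degree-or-zero (numerators-vanish g) | degree-or-zero (numerators-vanish h)
  ... | inj₂ G≡0 | _ = contradiction
        (trans (integer-factorisation g h f≈gh N) (∑-zero N λ {i} _ → cong (_* numerators h (N ∸ i)) (G≡0 i))) (Mφ≢0 g h)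
  ... | inj₁ _ | inj₂ H≡0 = contradiction
        (trans (integer-factorisation g h f≈gh N) (∑-zero N λ {i} _ → trans (cong (numerators g i *_) (H≡0 (N ∸ i))) (ℤ.*-zeroʳ (numerators g i))))
        (Mφ≢0 g h)
  ... | inj₁ (zero , _ , G-vanishes) | inj₁ _ = inj₁ λ k 1≤k → numerators≡0⇒coeff≡0 g k (G-vanishes 1≤k)
  ... | inj₁ (suc _ , _) | inj₁ (zero , _ , H-vanishes) = inj₂ (inj₁ λ k 1≤k → numerators≡0⇒coeff≡0 h k (H-vanishes 1≤k))
  ... | inj₁ (d@(suc _) , G-degree) | inj₁ (e@(suc _) , H-degree) = inj₂ (inj₂ (d , e , s≤s z≤n , s≤s z≤n , record
    { scale = + denominator g * + denominator h ; scale≢0 = M≢0 g h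
    ; left = numerators g ; right = numerators h ; left-degree = G-degree ; right-degree = H-degree
    ; factorises = integer-factorisation g h f≈gh }))

  irreducible-by-eisenstein :
    1 ≤ N → (∀ {d} → 1 ≤ d → d < N → ∃₂ λ p j → Prime p × EisensteinAt p N j φ × d ≢ j × d ≢ N ∸ j) →
    Irreducible f
  irreducible-by-eisenstein 1≤N excluded = nonconstant , λ g h f≈gh → constant-factor {g} {h} (proper-factorisation g h f≈gh)
    where
    nonconstant : ¬ IsConstant f
    nonconstant f-const = proj₁ φ-degree (ι-injective (trans (sym (f≗φ N)) (f-const N 1≤N)))

    no-proper-factorisation : ∀ {d e} → Factorisation φ d e → 1 ≤ d → 1 ≤ e → ⊥
    no-proper-factorisation {d} {e} fac 1≤d 1≤e =
      let d+e≡N = factorisation-degree fac φ-degree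
          p , j , p-prime , eis , d≢j , d≢N∸j = excluded 1≤d (subst (d <_) d+e≡N (ℕ.m<m+n d 1≤e))
      in [ d≢j , (λ e≡j → d≢N∸j (trans (sym (ℕ.m+n∸n≡m d e)) (cong₂ _∸_ d+e≡N e≡j))) ]′
           (eisenstein-factor-degree p-prime eis fac 1≤d 1≤e d+e≡N)

    constant-factor : ∀ {g h} → IsConstant g ⊎ IsConstant h ⊎ ∃₂ (λ d e → 1 ≤ d × 1 ≤ e × Factorisation φ d e) →
                      IsConstant g ⊎ IsConstant h
    constant-factor (inj₁ g-const)        = inj₁ g-const
    constant-factor (inj₂ (inj₁ h-const)) = inj₂ h-const
    constant-factor (inj₂ (inj₂ (_ , _ , 1≤d , 1≤e , fac))) = ⊥-elim (no-proper-factorisation fac 1≤d 1≤e)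

eisensteinAt⇒leading≢0 : ∀ {p N j φ} → EisensteinAt p N j φ → φ N ≢ 0ℤ
eisensteinAt⇒leading≢0 {N = N} {j} eis φN≡0 with j ℕ.≟ N
... | yes refl = proj₂ (EisensteinAt.monomialMod eis) (≡0⇒∣ φN≡0)
... | no  j≢N  = EisensteinAt.high eis j≢N (≡0⇒∣ φN≡0)

module _ {p N j : ℕ} {φ : ℕ → ℤ} (φ-vanishes : φ VanishesAbove N) where

  private
    BoundedEisenstein : Set
    BoundedEisenstein = (∀ {i} → i < suc N → i ≢ j → + p ∣ φ i) × ¬ + p ∣ φ j
                      × (j ≢ 0 → ¬ + p * + p ∣ φ 0) × (j ≢ N → ¬ + p * + p ∣ φ N)

    bounded⇔eisensteinAt : BoundedEisenstein ⇔ EisensteinAt p N j φ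
    bounded⇔eisensteinAt = mk⇔
      (λ (p∣φ , p∤φj , low , high) → record { monomialMod = others p∣φ , p∤φj ; low = low ; high = high })
      (λ eis → let open EisensteinAt eis in (λ {i} _ → proj₁ monomialMod) , proj₂ monomialMod , low , high)
      where
      others : (∀ {i} → i < suc N → i ≢ j → + p ∣ φ i) → ∀ {i} → i ≢ j → + p ∣ φ i
      others p∣φ {i} i≢j with i ≤? N
      ... | yes i≤N = p∣φ (s≤s i≤N) i≢j
      ... | no  i≰N = ≡0⇒∣ (φ-vanishes (ℕ.≰⇒> i≰N))

  eisensteinAt? : Dec (EisensteinAt p N j φ)
  eisensteinAt? = Dec.map bounded⇔eisensteinAt
    (allUpTo? (λ i → ¬? (i ℕ.≟ j) →-dec + p ∣? φ i) (suc N)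
     ×-dec ¬? (+ p ∣? φ j)
     ×-dec (¬? (j ℕ.≟ 0) →-dec ¬? (+ p * + p ∣? φ 0))
     ×-dec (¬? (j ℕ.≟ N) →-dec ¬? (+ p * + p ∣? φ N)))

-- The coefficients c_k and the certificate

-- Defs.c n k does not vanish for k > 4 (truncated subtraction makes it C(n,k)), so cut it off.
c≤4 : ℕ → ℕ → ℤ
c≤4 n (suc (suc (suc (suc (suc _))))) = 0ℤ
c≤4 n k                               = c n k

c≤4-vanishes : ∀ n → c≤4 n VanishesAbove 4
c≤4-vanishes n (s≤s (s≤s (s≤s (s≤s (s≤s _))))) = refl

Excludes : ℕ → ℕ → ℕ × ℕ → Set
Excludes n d (p , j) = Prime p × 5 ≤ p × EisensteinAt p 4 j (c≤4 n) × d ≢ j × d ≢ 4 ∸ j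

excludes? : ∀ n d w → Dec (Excludes n d w)
excludes? n d (p , j) =
  prime? p ×-dec 5 ≤? p ×-dec eisensteinAt? (c≤4-vanishes n) ×-dec ¬? (d ℕ.≟ j) ×-dec ¬? (d ℕ.≟ 4 ∸ j)

-- Found by an external search.
witnessTable : List (ℕ × List (ℕ × ℕ))
witnessTable =
  (9 , (5 , 4) ∷ []) ∷
  (10 , (5 , 0) ∷ []) ∷
  (11 , (7 , 4) ∷ []) ∷
  (12 , (11 , 1) ∷ (5 , 2) ∷ []) ∷
  (13 , (13 , 0) ∷ []) ∷
  (14 , (5 , 4) ∷ []) ∷
  (15 , (5 , 0) ∷ []) ∷
  (16 , (5 , 1) ∷ (7 , 2) ∷ []) ∷
  (17 , (13 , 4) ∷ []) ∷
  (18 , (7 , 4) ∷ []) ∷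
  (19 , (5 , 4) ∷ []) ∷
  (20 , (5 , 0) ∷ []) ∷
  (21 , (7 , 0) ∷ []) ∷
  (22 , (11 , 0) ∷ []) ∷
  (23 , (19 , 4) ∷ []) ∷
  (24 , (5 , 4) ∷ []) ∷
  (25 , (7 , 4) ∷ []) ∷
  (26 , (11 , 4) ∷ []) ∷
  (27 , (23 , 4) ∷ []) ∷
  (28 , (7 , 0) ∷ []) ∷
  (29 , (29 , 0) ∷ []) ∷
  (30 , (5 , 0) ∷ []) ∷
  (31 , (31 , 0) ∷ []) ∷
  (32 , (7 , 4) ∷ []) ∷
  (33 , (11 , 0) ∷ []) ∷
  (34 , (5 , 4) ∷ []) ∷
  (35 , (5 , 0) ∷ []) ∷
  (36 , (5 , 1) ∷ (17 , 2) ∷ []) ∷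
  (37 , (11 , 4) ∷ []) ∷
  (38 , (17 , 4) ∷ []) ∷
  (39 , (5 , 4) ∷ []) ∷
  (40 , (5 , 0) ∷ []) ∷
  (41 , (37 , 4) ∷ []) ∷
  (42 , (7 , 0) ∷ []) ∷
  (43 , (13 , 4) ∷ []) ∷
  (44 , (5 , 4) ∷ []) ∷
  (45 , (5 , 0) ∷ []) ∷
  (46 , (7 , 4) ∷ []) ∷
  (47 , (43 , 4) ∷ []) ∷
  (48 , (11 , 4) ∷ []) ∷
  (49 , (5 , 4) ∷ []) ∷
  (51 , (17 , 0) ∷ []) ∷
  (52 , (13 , 0) ∷ []) ∷
  (53 , (53 , 0) ∷ []) ∷
  (54 , (17 , 3) ∷ (13 , 2) ∷ []) ∷
  (55 , (5 , 0) ∷ []) ∷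
  (56 , (7 , 0) ∷ []) ∷
  (57 , (19 , 0) ∷ []) ∷
  (58 , (29 , 0) ∷ []) ∷
  (59 , (5 , 4) ∷ []) ∷
  (60 , (5 , 0) ∷ []) ∷
  (61 , (19 , 4) ∷ []) ∷
  (62 , (29 , 4) ∷ []) ∷
  (63 , (7 , 0) ∷ []) ∷
  (64 , (5 , 4) ∷ []) ∷
  (65 , (5 , 0) ∷ []) ∷
  (66 , (11 , 0) ∷ []) ∷
  (67 , (7 , 4) ∷ []) ∷
  (68 , (17 , 0) ∷ []) ∷
  (69 , (5 , 4) ∷ []) ∷
  (70 , (5 , 0) ∷ []) ∷
  (71 , (67 , 4) ∷ []) ∷
  (72 , (17 , 4) ∷ []) ∷
  (73 , (23 , 4) ∷ []) ∷
  (74 , (5 , 4) ∷ []) ∷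
  (75 , (71 , 4) ∷ []) ∷
  (76 , (19 , 0) ∷ []) ∷
  (77 , (7 , 0) ∷ []) ∷
  (78 , (13 , 0) ∷ []) ∷
  (79 , (79 , 0) ∷ []) ∷
  (80 , (5 , 0) ∷ []) ∷
  (81 , (7 , 4) ∷ []) ∷
  (82 , (13 , 4) ∷ []) ∷
  (83 , (79 , 4) ∷ []) ∷
  (84 , (5 , 4) ∷ []) ∷
  (85 , (5 , 0) ∷ []) ∷
  (86 , (41 , 4) ∷ []) ∷
  (87 , (29 , 0) ∷ []) ∷
  (88 , (7 , 4) ∷ []) ∷
  (89 , (5 , 4) ∷ []) ∷
  (90 , (5 , 0) ∷ []) ∷
  (91 , (7 , 0) ∷ []) ∷
  (92 , (11 , 4) ∷ []) ∷
  (93 , (31 , 0) ∷ []) ∷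
  (94 , (5 , 4) ∷ []) ∷
  (95 , (5 , 0) ∷ []) ∷
  (96 , (23 , 4) ∷ []) ∷
  (97 , (31 , 4) ∷ []) ∷
  (99 , (5 , 4) ∷ []) ∷
  (101 , (97 , 4) ∷ []) ∷
  (102 , (17 , 0) ∷ []) ∷
  (103 , (11 , 4) ∷ []) ∷
  (104 , (13 , 0) ∷ []) ∷
  (105 , (5 , 0) ∷ []) ∷
  (106 , (17 , 4) ∷ []) ∷
  (107 , (103 , 4) ∷ []) ∷
  (108 , (13 , 4) ∷ []) ∷
  (109 , (5 , 4) ∷ []) ∷
  (110 , (5 , 0) ∷ []) ∷
  (111 , (37 , 0) ∷ []) ∷
  (112 , (7 , 0) ∷ []) ∷
  (113 , (109 , 4) ∷ []) ∷
  (114 , (5 , 4) ∷ []) ∷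
  (115 , (5 , 0) ∷ []) ∷
  (116 , (7 , 4) ∷ []) ∷
  (117 , (13 , 0) ∷ []) ∷
  (118 , (19 , 4) ∷ []) ∷
  (119 , (5 , 4) ∷ []) ∷
  (120 , (5 , 0) ∷ []) ∷
  (121 , (13 , 4) ∷ []) ∷
  (122 , (59 , 4) ∷ []) ∷
  (123 , (7 , 4) ∷ []) ∷
  (124 , (5 , 4) ∷ []) ∷
  []

witnesses : ℕ → List (ℕ × ℕ)
witnesses n = concatMap (λ (m , ws) → if n ≡ᵇ m then ws else []) witnessTable

Certified : ℕ → Set
Certified n = ∀ {d} → d < 4 → 1 ≤ d → Any (Excludes n d) (witnesses n)

certified? : ∀ n → Dec (Certified n)
certified? n = allUpTo? (λ d → 1 ≤? d →-dec any? (excludes? n d) (witnesses n)) 4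

certified : ∀ {n} → n < 125 → 9 ≤ n → n ≢ 50 → n ≢ 98 → n ≢ 100 → Certified n
certified = toWitness {a? = allUpTo? (λ n → 9 ≤? n →-dec ¬? (n ℕ.≟ 50) →-dec ¬? (n ℕ.≟ 98) →-dec ¬? (n ℕ.≟ 100)
                                              →-dec certified? n) 125} _

smooth4⇒∤ : ∀ {a p} → Smooth4 a → Prime p → 5 ≤ p → ¬ + p ∣ a
smooth4⇒∤ (_ , small) p-prime 5≤p p∣a = ℕ.<-irrefl refl (ℕ.≤-trans 5≤p (small _ p-prime (∣⇒∣ᵤ p∣a)))

module Coefficients (a₀ a₁ a₂ a₃ a₄ : ℤ) (n : ℕ) where

  -- padded with 1s, which no prime divides
  a : ℕ → ℤ
  a 0 = a₀
  a 1 = a₁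
  a 2 = a₂
  a 3 = a₃
  a 4 = a₄
  a _ = + 1

  φ : ℕ → ℤ
  φ k = a k * c≤4 n k

  F≗φ : ∀ k → coeff (F n a₀ a₁ a₂ a₃ a₄) k ≡ ι (φ k)
  F≗φ 0 = refl
  F≗φ 1 = refl
  F≗φ 2 = refl
  F≗φ 3 = refl
  F≗φ 4 = refl
  F≗φ (suc (suc (suc (suc (suc _))))) = refl

  φ-vanishes : φ VanishesAbove 4
  φ-vanishes {k} 4<k = trans (cong (a k *_) (c≤4-vanishes n 4<k)) (ℤ.*-zeroʳ (a k))

  smooth4⇒a-coprime : Smooth4 a₀ → Smooth4 a₁ → Smooth4 a₂ → Smooth4 a₃ → Smooth4 a₄ →
                      ∀ {p} → Prime p → 5 ≤ p → ∀ k → ¬ + p ∣ a k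
  smooth4⇒a-coprime s₀ _  _  _  _  p-prime 5≤p 0 = smooth4⇒∤ s₀ p-prime 5≤p
  smooth4⇒a-coprime _  s₁ _  _  _  p-prime 5≤p 1 = smooth4⇒∤ s₁ p-prime 5≤p
  smooth4⇒a-coprime _  _  s₂ _  _  p-prime 5≤p 2 = smooth4⇒∤ s₂ p-prime 5≤p
  smooth4⇒a-coprime _  _  _  s₃ _  p-prime 5≤p 3 = smooth4⇒∤ s₃ p-prime 5≤p
  smooth4⇒a-coprime _  _  _  _  s₄ p-prime 5≤p 4 = smooth4⇒∤ s₄ p-prime 5≤p
  smooth4⇒a-coprime _  _  _  _  _  p-prime 5≤p (suc (suc (suc (suc (suc _))))) p∣1 with ℕ.∣1⇒≡1 (∣⇒∣ᵤ p∣1)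
  ... | refl = contradiction 5≤p λ { (s≤s ()) }

  excluded : (∀ {p} → Prime p → 5 ≤ p → ∀ k → ¬ + p ∣ a k) → Certified n →
             ∀ {d} → 1 ≤ d → d < 4 → ∃₂ λ p j → Prime p × EisensteinAt p 4 j φ × d ≢ j × d ≢ 4 ∸ j
  excluded a-coprime n-certified 1≤d d<4 with satisfied (n-certified d<4 1≤d)
  ... | (p , j) , p-prime , 5≤p , eis , d≢j , d≢4∸j =
    p , j , p-prime , eisensteinAt-scale p-prime a (a-coprime p-prime 5≤p) eis , d≢j , d≢4∸j

lemma4p2 : (a₀ a₁ a₂ a₃ a₄ : ℤ) → Smooth4 a₀ → Smooth4 a₁ → Smooth4 a₂ → Smooth4 a₃ → Smooth4 a₄ → (n : ℕ) → 8 ≤ n → n < 125 → n ≢ 8 → n ≢ 50 → n ≢ 98 → n ≢ 100 → Irreducible (F n a₀ a₁ a₂ a₃ a₄)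
lemma4p2 a₀ a₁ a₂ a₃ a₄ s₀ s₁ s₂ s₃ s₄ n 8≤n n<125 n≢8 n≢50 n≢98 n≢100 =
  irreducible-by-eisenstein {F n a₀ a₁ a₂ a₃ a₄} F≗φ (φ4≢0 , φ-vanishes) (s≤s z≤n) φ-excluded
  where
  open Coefficients a₀ a₁ a₂ a₃ a₄ n

  φ-excluded : ∀ {d} → 1 ≤ d → d < 4 → ∃₂ λ p j → Prime p × EisensteinAt p 4 j φ × d ≢ j × d ≢ 4 ∸ j
  φ-excluded = excluded (smooth4⇒a-coprime s₀ s₁ s₂ s₃ s₄)
                        (certified n<125 (ℕ.≤∧≢⇒< 8≤n (≢-sym n≢8)) n≢50 n≢98 n≢100)

  φ4≢0 : φ 4 ≢ 0ℤ
  φ4≢0 = let _ , _ , _ , eis , _ = φ-excluded {1} ℕ.≤-refl (s≤s (s≤s z≤n)) in eisensteinAt⇒leading≢0 eis
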